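{- Let $G$ be a graph whose $\operatorname{IR}$-graph $H=G(\operatorname{IR})$ is connected. If $G$ has an $\operatorname{IR}(G)$-set $X$ that contains $k\geq3$ vertices of positive degree in $G[X]$, or $k\geq 3$ vertices with $X$-external private neighbours, then $\operatorname{diam}(H)\geq k$.
   Context: All graphs are finite and simple. For $D\subseteq V(G)$, $v\in D$: $\operatorname{PN}(v,D)=N[v]-N[D-\{v\}]$, $\operatorname{EPN}(v,D)=\operatorname{PN}(v,D)-D$ (the $D$-external private neighbours of $v$). $D$ is irredundant if $\operatorname{PN}(v,D)\ne\varnothing$ for all $v\in D$; $\operatorname{IR}(G)$ is the max size of an irredundant set; an $\operatorname{IR}(G)$-set is an irredundant set of that size. $G(\operatorname{IR})$ has the $\operatorname{IR}(G)$-sets as vertices, $D\sim D'$ iff $D'=(D-\{u\})\cup\{v\}$ for some $u\in D$, $v\in D'$ with $uv\in E(G)$. -}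

module Defs where

open import Data.Nat using (ℕ; zero; suc; _≤_)
open import Data.Fin using (Fin)
open import Data.Fin.Subset using (Subset; _∈_; _∉_; _⊆_; _∪_; _-_; ⁅_⁆; ∣_∣)
open import Data.Sum using (_⊎_)
open import Data.Product using (Σ; ∃; ∃-syntax; _×_; _,_)
open import Relation.Binary.PropositionalEquality using (_≡_)
open import Relation.Nullary using (¬_)

record Graph (n : ℕ) : Set₁ where
  field
    Adj   : Fin n → Fin n → Set
    sym   : ∀ {u v} → Adj u v → Adj v u
    irrefl : ∀ {v} → ¬ Adj v v

module _ {n : ℕ} (G : Graph n) where
  open Graph G

  InClosedNbhd : Fin n → Fin n → Set
  InClosedNbhd v w = (w ≡ v) ⊎ Adj v w

  PrivNbr : Subset n → Fin n → Fin n → Set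
  PrivNbr D v w = InClosedNbhd v w × (∀ u → u ∈ D → ¬ (u ≡ v) → ¬ InClosedNbhd u w)

  ExtPrivNbr : Subset n → Fin n → Fin n → Set
  ExtPrivNbr D v w = PrivNbr D v w × w ∉ D

  Irredundant : Subset n → Set
  Irredundant D = ∀ v → v ∈ D → ∃[ w ] PrivNbr D v w

  IRSet : Subset n → Set
  IRSet D = Irredundant D × (∀ D' → Irredundant D' → ∣ D' ∣ ≤ ∣ D ∣)

  IRAdj : Subset n → Subset n → Set
  IRAdj D D' = IRSet D × IRSet D' ×
    (∃[ u ] ∃[ v ] (u ∈ D × v ∈ D' × Adj u v × D' ≡ (D - u) ∪ ⁅ v ⁆))

  data IRWalk : Subset n → Subset n → ℕ → Set where
    here : ∀ {D} → IRSet D → IRWalk D D zero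
    step : ∀ {D D' D'' ℓ} → IRAdj D D' → IRWalk D' D'' ℓ → IRWalk D D'' (suc ℓ)

  IRConnected : Set
  IRConnected = ∀ D D' → IRSet D → IRSet D' → ∃[ ℓ ] IRWalk D D' ℓ

  IRDiamAtLeast : ℕ → Set
  IRDiamAtLeast k = ∃[ D ] ∃[ D' ] (IRSet D × IRSet D' × (∀ ℓ → IRWalk D D' ℓ → k ≤ ℓ))

  PosDegIn : Subset n → Fin n → Set
  PosDegIn X v = ∃[ w ] (w ∈ X × Adj v w)

  ContainsK : (Fin n → Set) → Subset n → ℕ → Set
  ContainsK P X k = ∃[ S ] (S ⊆ X × ∣ S ∣ ≡ k × (∀ v → v ∈ S → P v))

module Submission where

-- Let X be an IR(G)-set and S ⊆ X a set of k vertices each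
-- having an X-external private neighbour (a vertex of positive degree in
-- G[X] is such a vertex, since its only possible private neighbours are
-- then outside X).  Choose for every v ∈ X a private neighbour p v, taking
-- an external one whenever v ∈ S.  The image Y = p[X] is again irredundant:
-- v itself is a Y-private neighbour of p v.  Moreover p is injective on X,
-- so |Y| ≥ |X| and Y is an IR(G)-set; and Y avoids S, because a private
-- neighbour of v lying inside X must be v itself.  Finally, one step of
-- G(IR) exchanges a single vertex, so a walk of length ℓ from X to Y can
-- remove at most ℓ vertices of X; as all of S has to be removed, ℓ ≥ k.

open import Defs
open import Data.Nat using (ℕ; zero; suc; _≤_; z≤n; s≤s)
open import Data.Nat.Properties using (≤-refl; ≤-reflexive; ≤-trans; n≤1+n; ≤-pred; module ≤-Reasoning)
open import Data.Fin using (Fin; zero; suc; _≟_)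
open import Data.Fin.Properties using (any?)
open import Data.Fin.Subset using (Nonempty; Subset; _∈_; _∉_; _⊆_; _-_; ⁅_⁆; ∣_∣; inside; outside)
open import Data.Fin.Subset.Properties
  using (_∈?_; nonempty?; Empty-unique; ∣⊥∣≡0; p─⊥≡p; x∈p⇒∣p-x∣<∣p∣; x∈p∧x≢y⇒x∈p-y;
         p─q⊆p; x∈p∪q⁺)
open import Data.Vec.Base using (_∷_; there; tabulate)
open import Data.Vec.Properties using (lookup∘tabulate; lookup⇒[]=; []=⇒lookup)
open import Data.Product using (∃-syntax; _×_; _,_; proj₁; proj₂)
open import Data.Sum using (_⊎_; inj₁; inj₂)
open import Relation.Nullary using (¬_; Dec; yes; no; does; contradiction)
open import Relation.Nullary.Decidable using (dec-true; decidable-stable; _×-dec_)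
open import Function using (_∘_)
open import Relation.Binary.PropositionalEquality using (_≡_; refl; sym; trans; subst)

private
  variable
    n : ℕ

decSubset : {P : Fin n → Set} → (∀ x → Dec (P x)) → Subset n
decSubset P? = tabulate (λ x → does (P? x))

∈-decSubset⁺ : ∀ {P : Fin n → Set} (P? : ∀ x → Dec (P x)) {x} → P x → x ∈ decSubset P?
∈-decSubset⁺ P? {x} px =
  lookup⇒[]= x _ (trans (lookup∘tabulate _ x) (dec-true (P? x) px))

∈-decSubset⁻ : ∀ {P : Fin n → Set} (P? : ∀ x → Dec (P x)) {x} → x ∈ decSubset P? → P x
∈-decSubset⁻ P? {x} x∈ = witness (P? x) (trans (sym (lookup∘tabulate _ x)) ([]=⇒lookup x∈))
  where
  witness : ∀ {A : Set} (a? : Dec A) → does a? ≡ inside → A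
  witness (yes a) _ = a

∈-⇒∈ : ∀ {p : Subset n} {x y} → x ∈ p - y → x ∈ p
∈-⇒∈ {p = p} {y = y} = p─q⊆p p ⁅ y ⁆

x∉p-x : ∀ (p : Subset n) x → x ∉ p - x
x∉p-x (_ ∷ p) zero    ()
x∉p-x (_ ∷ p) (suc x) (there x∈) = x∉p-x p x x∈

∈-⇒≢ : ∀ {p : Subset n} {x y} → x ∈ p - y → ¬ x ≡ y
∈-⇒≢ {p = p} {x = x} x∈ refl = x∉p-x p x x∈

empty⇒∣p∣≤0 : ∀ {p : Subset n} → ¬ Nonempty p → ∣ p ∣ ≤ 0
empty⇒∣p∣≤0 {n} p-empty =
  subst (λ q → ∣ q ∣ ≤ 0) (sym (Empty-unique p-empty)) (≤-reflexive (∣⊥∣≡0 n))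

∣p∣≤1+∣p-x∣ : ∀ (p : Subset n) x → ∣ p ∣ ≤ suc ∣ p - x ∣
∣p∣≤1+∣p-x∣ (b ∷ p) zero =
  subst (λ q → ∣ b ∷ p ∣ ≤ suc ∣ q ∣) (sym (p─⊥≡p p)) (head-bound b)
  where
  head-bound : ∀ b → ∣ b ∷ p ∣ ≤ suc ∣ p ∣
  head-bound inside  = ≤-refl
  head-bound outside = n≤1+n ∣ p ∣
∣p∣≤1+∣p-x∣ (inside  ∷ p) (suc x) = s≤s (∣p∣≤1+∣p-x∣ p x)
∣p∣≤1+∣p-x∣ (outside ∷ p) (suc x) = ∣p∣≤1+∣p-x∣ p x

injectiveOn⇒∣≤∣ : ∀ (P Q : Subset n) (f : Fin n → Fin n) →
  (∀ {x} → x ∈ P → f x ∈ Q) →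
  (∀ {x y} → x ∈ P → y ∈ P → f x ≡ f y → x ≡ y) →
  ∣ P ∣ ≤ ∣ Q ∣
injectiveOn⇒∣≤∣ P Q f maps inj = bounded _ P Q maps inj ≤-refl
  where
  bounded : ∀ m (P Q : Subset _) → (∀ {x} → x ∈ P → f x ∈ Q) →
    (∀ {x y} → x ∈ P → y ∈ P → f x ≡ f y → x ≡ y) → ∣ P ∣ ≤ m → ∣ P ∣ ≤ ∣ Q ∣
  bounded zero    P Q maps inj ∣P∣≤0 = ≤-trans ∣P∣≤0 z≤n
  bounded (suc m) P Q maps inj ∣P∣≤m with nonempty? P
  ... | no P-empty = ≤-trans (empty⇒∣p∣≤0 P-empty) z≤n
  ... | yes (x , x∈P) = begin
    ∣ P ∣             ≤⟨ ∣p∣≤1+∣p-x∣ P x ⟩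
    suc ∣ P - x ∣     ≤⟨ s≤s (bounded m (P - x) (Q - f x) maps′ inj′ ∣P-x∣≤m) ⟩
    suc ∣ Q - f x ∣   ≤⟨ x∈p⇒∣p-x∣<∣p∣ (maps x∈P) ⟩
    ∣ Q ∣             ∎
    where
    open ≤-Reasoning
    ∣P-x∣≤m : ∣ P - x ∣ ≤ m
    ∣P-x∣≤m = ≤-pred (≤-trans (x∈p⇒∣p-x∣<∣p∣ x∈P) ∣P∣≤m)
    maps′ : ∀ {y} → y ∈ P - x → f y ∈ Q - f x
    maps′ y∈ = x∈p∧x≢y⇒x∈p-y (maps (∈-⇒∈ y∈)) (λ fy≡fx → ∈-⇒≢ y∈ (inj (∈-⇒∈ y∈) x∈P fy≡fx))
    inj′ : ∀ {y z} → y ∈ P - x → z ∈ P - x → f y ≡ f z → y ≡ z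
    inj′ y∈ z∈ = inj (∈-⇒∈ y∈) (∈-⇒∈ z∈)

module _ {n : ℕ} (G : Graph n) where
  open Graph G renaming (sym to adj-sym)

  closedNbhd-sym : ∀ {u w} → InClosedNbhd G u w → InClosedNbhd G w u
  closedNbhd-sym (inj₁ w≡u) = inj₁ (sym w≡u)
  closedNbhd-sym (inj₂ adj) = inj₂ (adj-sym adj)

  privNbr-inside : ∀ {D v w} → PrivNbr G D v w → w ∈ D → w ≡ v
  privNbr-inside (_ , excl) w∈D =
    decidable-stable (_ ≟ _) (λ w≢v → excl _ w∈D w≢v (inj₁ refl))

  -- A vertex of an irredundant set X with a neighbour in X is not its own
  -- private neighbour, so each of its private neighbours is X-external.
  posDeg⇒extPrivNbr : ∀ {X v} → Irredundant G X → v ∈ X → PosDegIn G X v →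
    ∃[ w ] ExtPrivNbr G X v w
  posDeg⇒extPrivNbr {X} {v} irr v∈X (u , u∈X , adj) =
    let (w , pn) = irr v v∈X in w , pn , w∉X pn
    where
    w∉X : ∀ {w} → PrivNbr G X v w → w ∉ X
    w∉X pn w∈X with privNbr-inside pn w∈X
    ... | refl = proj₂ pn u u∈X (λ { refl → irrefl adj }) (inj₂ (adj-sym adj))

  module PrivNbrSystem (X : Subset n) (p : Fin n → Fin n)
                       (pn : ∀ {v} → v ∈ X → PrivNbr G X v (p v)) where

    InImage : Fin n → Set
    InImage w = ∃[ v ] (v ∈ X × p v ≡ w)

    inImage? : ∀ w → Dec (InImage w)
    inImage? w = any? (λ v → (v ∈? X) ×-dec (p v ≟ w))

    image : Subset n
    image = decSubset inImage?

    ∈-image⁺ : ∀ {v} → v ∈ X → p v ∈ image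
    ∈-image⁺ {v} v∈X = ∈-decSubset⁺ inImage? (v , v∈X , refl)

    ∈-image⁻ : ∀ {w} → w ∈ image → InImage w
    ∈-image⁻ = ∈-decSubset⁻ inImage?

    -- p is injective on X: p y ∈ PN(y, X) cannot lie in N[x] for x ≠ y.
    p-injective : ∀ {x y} → x ∈ X → y ∈ X → p x ≡ p y → x ≡ y
    p-injective {x} {y} x∈X y∈X px≡py = decidable-stable (x ≟ y) λ x≢y →
      proj₂ (pn y∈X) x x∈X x≢y (subst (InClosedNbhd G x) px≡py (proj₁ (pn x∈X)))

    ∣X∣≤∣image∣ : ∣ X ∣ ≤ ∣ image ∣
    ∣X∣≤∣image∣ = injectiveOn⇒∣≤∣ X image p ∈-image⁺ p-injective

    -- v is a private neighbour of p v with respect to p[X]: a different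
    -- p t ∈ p[X] with v ∈ N[p t] would put p t ∈ PN(t, X) into N[v].
    image-irredundant : Irredundant G image
    image-irredundant w w∈ with ∈-image⁻ w∈
    ... | v , v∈X , refl = v , closedNbhd-sym (proj₁ (pn v∈X)) , excl
      where
      excl : ∀ u → u ∈ image → ¬ u ≡ p v → ¬ InClosedNbhd G u v
      excl u u∈ u≢pv with ∈-image⁻ u∈
      ... | t , t∈X , refl = λ v∈N[pt] →
        proj₂ (pn t∈X) v v∈X (λ { refl → u≢pv refl }) (closedNbhd-sym v∈N[pt])

    image-IRSet : IRSet G X → IRSet G image
    image-IRSet (_ , maximum) =
      image-irredundant , λ D irr → ≤-trans (maximum D irr) ∣X∣≤∣image∣

  externalOn : ∀ {X S} → Irredundant G X → S ⊆ X →
    (∀ v → v ∈ S → ∃[ w ] ExtPrivNbr G X v w) →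
    ∃[ p ] ((∀ {v} → v ∈ X → PrivNbr G X v (p v)) × (∀ {v} → v ∈ S → p v ∉ X))
  externalOn {X} {S} irr S⊆X ext =
    (λ v → proj₁ (choice v)) , (λ v∈X → proj₁ (proj₂ (choice _)) v∈X)
                             , (λ v∈S → proj₂ (proj₂ (choice _)) v∈S)
    where
    choice : ∀ v → ∃[ w ] ((v ∈ X → PrivNbr G X v w) × (v ∈ S → w ∉ X))
    choice v with v ∈? S | v ∈? X
    ... | yes v∈S | _       = let (w , pn , w∉X) = ext v v∈S in w , (λ _ → pn) , (λ _ → w∉X)
    ... | no  v∉S | yes v∈X = let (w , pn) = irr v v∈X in w , (λ _ → pn) , (λ v∈S → contradiction v∈S v∉S)
    ... | no  v∉S | no  v∉X = v , (λ v∈X → contradiction v∈X v∉X) , (λ v∈S → contradiction (S⊆X v∈S) v∉X)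

  -- In G(IR) each step removes a single vertex, so a walk from D to D′ of
  -- length ℓ has ℓ ≥ ∣ S ∣ for every S ⊆ D disjoint from D′.
  walk-length-bound : ∀ {D D′ ℓ} → IRWalk G D D′ ℓ →
    ∀ {S} → S ⊆ D → (∀ {v} → v ∈ S → v ∉ D′) → ∣ S ∣ ≤ ℓ
  walk-length-bound (here _) S⊆D disjoint =
    empty⇒∣p∣≤0 (λ (v , v∈S) → disjoint v∈S (S⊆D v∈S))
  walk-length-bound (step (_ , _ , u , _ , _ , _ , _ , D₁≡) walk) {S} S⊆D disjoint =
    ≤-trans (∣p∣≤1+∣p-x∣ S u) (s≤s (walk-length-bound walk S-u⊆D₁ (disjoint ∘ ∈-⇒∈)))
    where
    S-u⊆D₁ : S - u ⊆ _
    S-u⊆D₁ v∈ = subst (_ ∈_) (sym D₁≡)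
      (x∈p∪q⁺ (inj₁ (x∈p∧x≢y⇒x∈p-y (S⊆D (∈-⇒∈ v∈)) (∈-⇒≢ v∈))))

  extPrivNbrs⇒diam : ∀ {X k} → IRSet G X →
    ContainsK G (λ v → ∃[ w ] ExtPrivNbr G X v w) X k → IRDiamAtLeast G k
  extPrivNbrs⇒diam {X} IR-X@(irr , _) (S , S⊆X , refl , ext)
    with externalOn irr S⊆X ext
  ... | p , p-private , p-external =
    X , image , IR-X , image-IRSet IR-X ,
    λ ℓ walk → walk-length-bound walk S⊆X S∩image≡∅
    where
    open PrivNbrSystem X p p-private

    -- If p t ∈ S ⊆ X then p t = t, so t ∈ S and p t ∉ X: impossible.
    S∩image≡∅ : ∀ {v} → v ∈ S → v ∉ image
    S∩image≡∅ v∈S v∈ with ∈-image⁻ v∈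
    ... | t , t∈X , refl =
      p-external (subst (_∈ S) (privNbr-inside (p-private t∈X) (S⊆X v∈S)) v∈S) (S⊆X v∈S)

-- Corollary 4.4: vertices of positive degree in G[X] have X-external private
-- neighbours, so both alternatives reduce to extPrivNbrs⇒diam.
corollary4p4 : ∀ {n} (G : Graph n) → IRConnected G →
    ∀ (X : Subset n) (k : ℕ) → IRSet G X → 3 ≤ k →
    (ContainsK G (PosDegIn G X) X k ⊎ ContainsK G (λ v → ∃[ w ] ExtPrivNbr G X v w) X k) →
    IRDiamAtLeast G k
corollary4p4 G _ X k IR-X _ (inj₂ extPrivNbrs) = extPrivNbrs⇒diam G IR-X extPrivNbrs
corollary4p4 G _ X k IR-X _ (inj₁ (S , S⊆X , ∣S∣≡k , posDeg)) =
  extPrivNbrs⇒diam G IR-X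
    (S , S⊆X , ∣S∣≡k , λ v v∈S → posDeg⇒extPrivNbr G (proj₁ IR-X) (S⊆X v∈S) (posDeg v v∈S))
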